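{- (Preservation) Let $\Sigma$ be a signature and $V$ a set of process definitions over $\Sigma$. If $\bar x:\omega\Vdash\mathcal C::(y:A)$ and $\mathcal C\mapsto\mathcal C'$ by one transition step, then $\bar u:\omega\Vdash\mathcal C'::(w:A)$ for some channels $\bar u$ and $w$.
   Context: Signature $\Sigma$: finite set of type definitions $t=^i_aA$ with polarity $a\in\{\mu,\nu\}$ and priority $i$; types $A::=\oplus\{\ell:A_\ell\}_{\ell\in L}\mid\&\{\ell:A_\ell\}_{\ell\in L}\mid1\mid t$. Processes: $P::=y\leftarrow x\mid(x\leftarrow P_x;Q_x)\mid Rx.k;P\mid\mathbf{case}\,Lx(\ell\Rightarrow Q_\ell)\mid\mathbf{case}\,Rx(\ell\Rightarrow P_\ell)\mid Lx.k;P\mid\mathbf{close}\,Rx\mid\mathbf{wait}\,Lx;Q\mid Rx.\mu_t;P\mid\mathbf{case}\,Lx(\mu_t\Rightarrow P)\mid\mathbf{case}\,Rx(\nu_t\Rightarrow P)\mid Lx.\nu_t;P\mid y\leftarrow X\leftarrow\bar x$; definitions $\bar u:\omega\vdash X=P_{\bar u,w}::(w:C)\in V$. Process typing $\bar x:\omega\vdash P::(y:C)$ ($\omega$ empty iff $\bar x$ empty): Id $x:A\vdash y\leftarrow x::(y:A)$; Cut from $\bar x:\omega\vdash P_w::(w:A)$ and $w:A\vdash Q_w::(y:C)$; $\oplus R$: $Ry.k;P$ at $\oplus\{\ell:A_\ell\}$ if $P::(y:A_k)$; $\oplus L$: $\mathbf{case}\,Lx(\ell\Rightarrow P_\ell)$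 from $x:A_\ell\vdash P_\ell$ for all $\ell$; $\&R$: $\mathbf{case}\,Ry(\ell\Rightarrow P_\ell)$ at $\&\{\ell:A_\ell\}$ if $P_\ell::(y:A_\ell)$ for all $\ell$; $\&L$: $Lx.k;P$ from $x:A_k\vdash P$; $1R$: $\cdot\vdash\mathbf{close}\,Ry::(y:1)$; $1L$: $x:1\vdash\mathbf{wait}\,Lx;Q$ from $\cdot\vdash Q$; $\mu R$: $Ry.\mu_t;P::(y:t)$ if $P::(y:A)$, $t=_\mu A$; $\mu L$: $x:t\vdash\mathbf{case}\,Lx(\mu_t\Rightarrow Q)$ from $x:A\vdash Q$; $\nu R$: $\mathbf{case}\,Ry(\nu_t\Rightarrow P)::(y:t)$ if $P::(y:A)$, $t=_\nu A$; $\nu L$: $x:t\vdash Lx.\nu_t;Q$ from $x:A\vdash Q$; Def: $y\leftarrow X\leftarrow\bar x$ typed by $X$'s definition if its body instantiated with $\bar x,y$ is typed (infinitary derivations allowed). Configurations $\mathcal C::=\cdot\mid P\mid\mathcal C_1\mid_x\mathcal C_2$ (associative, unit $\cdot$, non-commutative), typed by: $x:A\Vdash\cdot::(x:A)$; $\bar x:\omega\Vdash P::(y:B)$ if $\bar x:\omega\vdash P::(y:B)$; $\bar x:\omega\Vdash\mathcal C_1\mid_z\mathcal C_2::(y:B)$ if $\bar x:\omega\Vdash\mathcal C_1::(z:A)$ and $z:A\Vdash\mathcal C_2::(y:B)$. Transitions (anywhere in a configuration, $z$ fresh): $P_x\mid_x(y\leftarrow x)\mid_yQ_y\mapsto P_z\mid_zQ_z$;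 $(x\leftarrow P_x;Q_x)\mapsto P_z\mid_zQ_z$; $(Rx.k;P)\mid_x\mathbf{case}\,Lx(\ell\Rightarrow Q_\ell)\mapsto P\mid_xQ_k$; $\mathbf{case}\,Rx(\ell\Rightarrow P_\ell)\mid_x(Lx.k;Q)\mapsto P_k\mid_xQ$; $\mathbf{close}\,Rx\mid_x(\mathbf{wait}\,Lx;Q)\mapsto Q$; $(Rx.\mu_t;P)\mid_x\mathbf{case}\,Lx(\mu_t\Rightarrow Q)\mapsto P\mid_xQ$; $\mathbf{case}\,Rx(\nu_t\Rightarrow P)\mid_x(Lx.\nu_t;Q)\mapsto P\mid_xQ$; $\bar y\leftarrow X\leftarrow\bar x\mapsto P_{\bar x,\bar y}$ where $X=P_{\bar u,\bar w}$ in $V$. -}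

module Defs where

open import Data.Nat using (ℕ; _≟_)
open import Data.List using (List; []; _∷_; [_]; _++_)
open import Data.Maybe using (Maybe; just; nothing)
open import Data.Product using (Σ; _×_; _,_; ∃)
open import Relation.Nullary using (yes; no)
open import Relation.Binary.PropositionalEquality using (_≡_)
open import Level using () renaming (suc to lsuc; zero to lzero)

Label : Set
Label = ℕ

TName : Set
TName = ℕ

PName : Set
PName = ℕ

lookupL : {X : Set} → ℕ → List (ℕ × X) → Maybe X
lookupL k [] = nothing
lookupL k ((ℓ , x) ∷ xs) with k ≟ ℓ
... | yes _ = just x
... | no  _ = lookupL k xs

-- Types  A ::= ⊕{ℓ:A_ℓ}_{ℓ∈L} | &{ℓ:A_ℓ}_{ℓ∈L} | 1 | t
-- A labelled family {ℓ:A_ℓ}_{ℓ∈L} is a finite map Label ⇀ Tp, given as an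
-- association list read with lookupL (its domain is the label set L).

data Tp : Set where
  ⊕[_] : List (Label × Tp) → Tp
  &[_] : List (Label × Tp) → Tp
  𝟙    : Tp
  `_   : TName → Tp

data Pol : Set where
  μ ν : Pol

-- Signature: finite set of definitions t =^i_a A, as a finite map
-- t ↦ (a , i , A)
Sig : Set
Sig = List (TName × (Pol × ℕ × Tp))

data Proc : Set where
  fwd    : Proc                                  -- y ← x
  cut    : Proc → Proc → Proc                    -- (x ← P_x ; Q_x)
  selR   : Label → Proc → Proc                   -- R x.k ; P
  caseL  : List (Label × Proc) → Proc            -- case L x (ℓ ⇒ Q_ℓ)
  caseR  : List (Label × Proc) → Proc            -- case R x (ℓ ⇒ P_ℓ)
  selL   : Label → Proc → Proc                   -- L x.k ; P
  closeR : Proc                                  -- close R x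
  waitL  : Proc → Proc                           -- wait L x ; Q
  μR     : TName → Proc → Proc                   -- R x.μ_t ; P
  μL     : TName → Proc → Proc                   -- case L x (μ_t ⇒ P)
  νR     : TName → Proc → Proc                   -- case R x (ν_t ⇒ P)
  νL     : TName → Proc → Proc                   -- L x.ν_t ; P
  call   : PName → Proc                          -- y ← X ← x̄

-- a process definition  ū:ω ⊢ X = P_{ū,w} :: (w:C)
record PDef : Set where
  constructor pdef
  field
    ctx  : Maybe Tp      -- ω (nothing = empty antecedent)
    tp   : Tp
    body : Proc
open PDef public

Prog : Set
Prog = List (PName × PDef)

-- Process typing   ω ⊢ P :: C   (ω : Maybe Tp, empty or one antecedent)
-- One-step rule instances over a relation R of premises.

Rel : Set₁
Rel = Maybe Tp → Proc → Tp → Set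

-- Configurations: C ::= · | P | C₁ | C₂  (associative, unit ·,
-- non-commutative) = the free monoid on processes, i.e. lists;
-- · = [], P = [ P ], C₁ | C₂ = C₁ ++ C₂.

Config : Set
Config = List Proc


module _ (Sg : Sig) (V : Prog) where

  data Rule (R : Rel) : Rel where
    Id   : ∀ {A} → Rule R (just A) fwd A
    Cut  : ∀ {ω P Q A C} → R ω P A → R (just A) Q C → Rule R ω (cut P Q) C
    ⊕R   : ∀ {ω k L A P} → lookupL k L ≡ just A → R ω P A →
           Rule R ω (selR k P) ⊕[ L ]
    ⊕L   : ∀ {L bs C} →
           (∀ ℓ A → lookupL ℓ L ≡ just A →
              Σ Proc λ Q → lookupL ℓ bs ≡ just Q × R (just A) Q C) →
           (∀ ℓ Q → lookupL ℓ bs ≡ just Q → ∃ λ A → lookupL ℓ L ≡ just A) →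
           Rule R (just ⊕[ L ]) (caseL bs) C
    &R   : ∀ {ω L bs} →
           (∀ ℓ A → lookupL ℓ L ≡ just A →
              Σ Proc λ P → lookupL ℓ bs ≡ just P × R ω P A) →
           (∀ ℓ P → lookupL ℓ bs ≡ just P → ∃ λ A → lookupL ℓ L ≡ just A) →
           Rule R ω (caseR bs) &[ L ]
    &L   : ∀ {k L A Q C} → lookupL k L ≡ just A → R (just A) Q C →
           Rule R (just &[ L ]) (selL k Q) C
    𝟙R   : Rule R nothing closeR 𝟙
    𝟙L   : ∀ {Q C} → R nothing Q C → Rule R (just 𝟙) (waitL Q) C
    μRule-R : ∀ {ω t i A P} → lookupL t Sg ≡ just (μ , i , A) → R ω P A →
           Rule R ω (μR t P) (` t)
    μRule-L : ∀ {t i A Q C} → lookupL t Sg ≡ just (μ , i , A) → R (just A) Q C →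
           Rule R (just (` t)) (μL t Q) C
    νRule-R : ∀ {ω t i A P} → lookupL t Sg ≡ just (ν , i , A) → R ω P A →
           Rule R ω (νR t P) (` t)
    νRule-L : ∀ {t i A Q C} → lookupL t Sg ≡ just (ν , i , A) → R (just A) Q C →
           Rule R (just (` t)) (νL t Q) C
    Def  : ∀ {ω X d C} → lookupL X V ≡ just d → ctx d ≡ ω → tp d ≡ C →
           R ω (body d) C → Rule R ω (call X) C

  -- Infinitary (non-well-founded) derivability: the greatest fixed point
  -- of the rules, i.e. the judgement lies in some relation closed backwards
  -- under the rules.
  _⊢_∷_ : Maybe Tp → Proc → Tp → Set₁
  ω ⊢ P ∷ C = Σ Rel λ R → (∀ {ω′ P′ C′} → R ω′ P′ C′ → Rule R ω′ P′ C′) × R ω P C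

  data _⊩_∷_ : Maybe Tp → Config → Tp → Set₁ where
    emp  : ∀ {A} → just A ⊩ [] ∷ A
    proc : ∀ {ω P B} → ω ⊢ P ∷ B → ω ⊩ [ P ] ∷ B
    comp : ∀ {ω C₁ C₂ A B} → ω ⊩ C₁ ∷ A → just A ⊩ C₂ ∷ B → ω ⊩ (C₁ ++ C₂) ∷ B

module _ (V : Prog) where

  data _⟶_ : Config → Config → Set where
    fwd-step  : ∀ {P Q} → (P ∷ fwd ∷ Q ∷ []) ⟶ (P ∷ Q ∷ [])
    cut-step  : ∀ {P Q} → [ cut P Q ] ⟶ (P ∷ Q ∷ [])
    ⊕-step    : ∀ {k P bs Q} → lookupL k bs ≡ just Q →
                (selR k P ∷ caseL bs ∷ []) ⟶ (P ∷ Q ∷ [])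
    &-step    : ∀ {k bs P Q} → lookupL k bs ≡ just P →
                (caseR bs ∷ selL k Q ∷ []) ⟶ (P ∷ Q ∷ [])
    𝟙-step    : ∀ {Q} → (closeR ∷ waitL Q ∷ []) ⟶ [ Q ]
    μ-step    : ∀ {t P Q} → (μR t P ∷ μL t Q ∷ []) ⟶ (P ∷ Q ∷ [])
    ν-step    : ∀ {t P Q} → (νR t P ∷ νL t Q ∷ []) ⟶ (P ∷ Q ∷ [])
    def-step  : ∀ {X d} → lookupL X V ≡ just d → [ call X ] ⟶ [ body d ]

  data _↦_ : Config → Config → Set where
    step : ∀ {C₁ C₂ R R′} → R ⟶ R′ → (C₁ ++ R ++ C₂) ↦ (C₁ ++ R′ ++ C₂)

module Submission where

-- A configuration C₁ | … | Cₙ is typed by a chain of process typings whose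
-- interfaces match up.  The relation _⊩_∷_ builds such chains with arbitrary
-- bracketing; it is equivalent to a right-nested list form (Chain), in which
-- typings can be appended, cut after any nonempty prefix, and rewritten
-- underneath a typed prefix.  A transition rewrites a redex R to R′ inside
-- C₁ ++ R ++ C₂.  Walking past C₁ (under-prefix) and cutting the redex off
-- the rest C₂ (split) isolates a typing of R alone; local preservation
-- (reduce: one case per reduction, by inversion of the last rule of the
-- non-well-founded derivations involved) retypes R′ with the same interface,
-- and appending C₂ again types the result.  Inverting an infinitary
-- derivation (R , closed , r) exposes a rule instance whose premises lie in
-- the same backward-closed relation R, so each premise is itself a
-- derivation (lemma derivable).

open import Defs
open import Data.Maybe using (Maybe; just)
open import Data.Maybe.Properties using (just-injective)
open import Data.List using ([]; _∷_; _++_)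
open import Data.Product using (Σ; _×_; _,_)
open import Relation.Binary.PropositionalEquality using (_≡_; refl; sym; trans)

-- An optional value is just one value; used on lookups in a finite map, it
-- makes the branch (unfolding, body) chosen by a reduction agree with the
-- one that was typed.
just-unique : {X : Set} {m : Maybe X} {a b : X} → m ≡ just a → m ≡ just b → a ≡ b
just-unique ea eb = just-injective (trans (sym ea) eb)

module Preservation (Sg : Sig) (V : Prog) where

  BackwardClosed : Rel → Set
  BackwardClosed R = ∀ {ω P C} → R ω P C → Rule Sg V R ω P C

  derivable : ∀ {R} → BackwardClosed R → ∀ {ω P C} → R ω P C → _⊢_∷_ Sg V ω P C
  derivable {R} closed r = R , closed , r

  data Chain : Maybe Tp → Config → Tp → Set₁ where
    nil  : ∀ {A} → Chain (just A) [] A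
    cons : ∀ {ω P A Cs B} → _⊢_∷_ Sg V ω P A → Chain (just A) Cs B →
           Chain ω (P ∷ Cs) B

  _++ᶜ_ : ∀ {ω C₁ C₂ A B} → Chain ω C₁ A → Chain (just A) C₂ B →
          Chain ω (C₁ ++ C₂) B
  nil      ++ᶜ c′ = c′
  cons d c ++ᶜ c′ = cons d (c ++ᶜ c′)

  -- Conversely a chain can be cut after any nonempty prefix, through some
  -- interface A.  (An empty prefix cannot be cut off an empty antecedent.)
  split : ∀ {ω C₂ B} (P : Proc) (C₁ : Config) → Chain ω (P ∷ C₁ ++ C₂) B →
          Σ Tp λ A → Chain ω (P ∷ C₁) A × Chain (just A) C₂ B
  split P []       (cons d c) = _ , cons d nil , c
  split P (Q ∷ C₁) (cons d c) with split Q C₁ c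
  ... | A , c₁ , c₂ = A , cons d c₁ , c₂

  under-prefix : ∀ {X Y B} (C₁ : Config) →
                 (∀ {ω} → Chain ω X B → Chain ω Y B) →
                 ∀ {ω} → Chain ω (C₁ ++ X) B → Chain ω (C₁ ++ Y) B
  under-prefix []       f c          = f c
  under-prefix (P ∷ C₁) f (cons d c) = cons d (under-prefix C₁ f c)

  fromConfig : ∀ {ω C A} → _⊩_∷_ Sg V ω C A → Chain ω C A
  fromConfig emp          = nil
  fromConfig (proc d)     = cons d nil
  fromConfig (comp c₁ c₂) = fromConfig c₁ ++ᶜ fromConfig c₂

  toConfig : ∀ {ω C A} → Chain ω C A → _⊩_∷_ Sg V ω C A
  toConfig nil        = emp
  toConfig (cons d c) = comp (proc d) (toConfig c)

  -- Each case inverts the last rule of the interacting derivations; the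
  -- principal rules match up (same label, same unfolding of t, same
  -- definition body) by uniqueness of lookups.
  reduce : ∀ {ω R R′ A} → _⟶_ V R R′ → Chain ω R A → Chain ω R′ A
  reduce fwd-step (cons d₁ (cons (_ , cl , r) (cons d₃ nil))) with cl r
  ... | Id = cons d₁ (cons d₃ nil)
  reduce cut-step (cons (_ , cl , r) nil) with cl r
  ... | Cut rP rQ = cons (derivable cl rP) (cons (derivable cl rQ) nil)
  reduce (⊕-step eQ) (cons (_ , cl₁ , r₁) (cons (_ , cl₂ , r₂) nil))
    with cl₁ r₁ | cl₂ r₂
  ... | ⊕R eA rP | ⊕L branch _ with branch _ _ eA
  ... | _ , eQ′ , rQ with just-unique eQ eQ′
  ... | refl = cons (derivable cl₁ rP) (cons (derivable cl₂ rQ) nil)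
  reduce (&-step eP) (cons (_ , cl₁ , r₁) (cons (_ , cl₂ , r₂) nil))
    with cl₁ r₁ | cl₂ r₂
  ... | &R branch _ | &L eA rQ with branch _ _ eA
  ... | _ , eP′ , rP with just-unique eP eP′
  ... | refl = cons (derivable cl₁ rP) (cons (derivable cl₂ rQ) nil)
  reduce 𝟙-step (cons (_ , cl₁ , r₁) (cons (_ , cl₂ , r₂) nil))
    with cl₁ r₁ | cl₂ r₂
  ... | 𝟙R | 𝟙L rQ = cons (derivable cl₂ rQ) nil
  reduce μ-step (cons (_ , cl₁ , r₁) (cons (_ , cl₂ , r₂) nil))
    with cl₁ r₁ | cl₂ r₂
  ... | μRule-R e₁ rP | μRule-L e₂ rQ with just-unique e₁ e₂
  ... | refl = cons (derivable cl₁ rP) (cons (derivable cl₂ rQ) nil)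
  reduce ν-step (cons (_ , cl₁ , r₁) (cons (_ , cl₂ , r₂) nil))
    with cl₁ r₁ | cl₂ r₂
  ... | νRule-R e₁ rP | νRule-L e₂ rQ with just-unique e₁ e₂
  ... | refl = cons (derivable cl₁ rP) (cons (derivable cl₂ rQ) nil)
  reduce (def-step eX) (cons (_ , cl , r) nil) with cl r
  ... | Def eX′ refl refl rBody with just-unique eX eX′
  ... | refl = cons (derivable cl rBody) nil

  -- A redex followed by any rest of the configuration: cut the redex off,
  -- reduce it, and reattach the rest.  Every redex is nonempty.
  reduce-prefix : ∀ {ω R R′ C₂ B} → _⟶_ V R R′ →
                  Chain ω (R ++ C₂) B → Chain ω (R′ ++ C₂) B
  reduce-prefix {R = P ∷ R₀} s c with split P R₀ c
  ... | _ , cR , c₂ = reduce s cR ++ᶜ c₂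

open Preservation using (fromConfig; toConfig; under-prefix; reduce-prefix)

mainTheorem7 : (Sg : Sig) (V : Prog) (ω : Maybe Tp) (C C′ : Config) (A : Tp) →
    _⊩_∷_ Sg V ω C A → _↦_ V C C′ → _⊩_∷_ Sg V ω C′ A
mainTheorem7 Sg V ω _ _ A typed (step {C₁} s) =
  toConfig Sg V (under-prefix Sg V C₁ (reduce-prefix Sg V s) (fromConfig Sg V typed))
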